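{- For every $X\in P$, $G$ is defined at $XA_1$ and at $XA_0$, and $G(XA_1)=X$ and $G(XA_0)=X$.
   Context: Let $A_0=\begin{pmatrix}0&0&1\\1&0&0\\0&1&1\end{pmatrix}$, $A_1=\begin{pmatrix}1&0&1\\0&1&0\\0&0&1\end{pmatrix}$, so for row vectors $(x,y,z)A_0=(y,z,x+z)$ and $(x,y,z)A_1=(x,y,x+z)$. Let $P=\{(x,y,z)\in\mathbb Z^3:0<x\le y<z\}\cup\{(1,1,1)\}$. The inverse map $G$ is the partially defined map on integer triples given by $G(a,b,c)=(a,b,c-a)$ if $a+b<c$, and $G(a,b,c)=(c-b,a,b)$ if $a+b\ge c$ and either $a<b$ or $a=1=c-b$; $G$ is undefined otherwise. -}

module Defs where

open import Data.Integer using (ℤ; _+_; _-_; _<_; _≤_; _<?_; _≤?_; _≟_; +_)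
open import Data.Product using (_×_; _,_)
open import Data.Sum using (_⊎_)
open import Data.Maybe using (Maybe; just; nothing)
open import Relation.Nullary using (yes; no)
open import Relation.Binary.PropositionalEquality using (_≡_)

-- integer triples, viewed as row vectors (x , y , z)
Triple : Set
Triple = ℤ × ℤ × ℤ

mulA0 : Triple → Triple
mulA0 (x , y , z) = (y , z , x + z)

mulA1 : Triple → Triple
mulA1 (x , y , z) = (x , y , x + z)

InP : Triple → Set
InP (x , y , z) = ((+ 0 < x) × (x ≤ y) × (y < z)) ⊎ ((x , y , z) ≡ (+ 1 , + 1 , + 1))

G : Triple → Maybe Triple
G (a , b , c) with (a + b) <? c
... | yes _ = just (a , b , c - a)
... | no _ with a <? b
...   | yes _ = just (c - b , a , b)
...   | no _ with a ≟ + 1 | c - b ≟ + 1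
...     | yes _ | yes _ = just (c - b , a , b)
...     | _     | _     = nothing

-- For x ≤ y < z, the image (x, y, x + z) under A₁ has x + y < x + z, so G takes the
-- subtracting branch and returns (x, y, z); the image (y, z, x + z) under A₀ has
-- y + z ≥ x + z and y < z, so G takes the rotating branch and recovers x = (x + z) − z.
module Submission where

open import Defs
open import Data.Integer using (_+_; _-_; _<_; _≤_; _<?_)
open import Data.Integer.Properties
  using (+-0-abelianGroup; +-monoʳ-<; +-monoˡ-≤; ≤⇒≯)
open import Algebra.Properties.AbelianGroup +-0-abelianGroup
  using (xyx⁻¹≈y; //-rightDividesʳ)
open import Data.Maybe using (just)
open import Data.Product using (_×_; _,_)
open import Data.Sum using (inj₁; inj₂)
open import Relation.Binary.PropositionalEquality using (_≡_; refl; cong)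
open import Relation.Nullary using (yes; no; ¬_)
open import Relation.Nullary.Negation using (contradiction)

G-subtract : ∀ a b c → a + b < c → G (a , b , c) ≡ just (a , b , c - a)
G-subtract a b c a+b<c with (a + b) <? c
... | yes _    = refl
... | no a+b≮c = contradiction a+b<c a+b≮c

G-rotate : ∀ a b c → ¬ (a + b < c) → a < b → G (a , b , c) ≡ just (c - b , a , b)
G-rotate a b c a+b≮c a<b with (a + b) <? c
... | yes a+b<c = contradiction a+b<c a+b≮c
... | no _ with a <? b
...   | yes _   = refl
...   | no a≮b  = contradiction a<b a≮b

G-mulA1 : ∀ {x y z} → y < z → G (mulA1 (x , y , z)) ≡ just (x , y , z)
G-mulA1 {x} {y} {z} y<z
  rewrite G-subtract x y (x + z) (+-monoʳ-< x y<z) = cong (λ w → just (x , y , w)) (xyx⁻¹≈y x z)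

G-mulA0 : ∀ {x y z} → x ≤ y → y < z → G (mulA0 (x , y , z)) ≡ just (x , y , z)
G-mulA0 {x} {y} {z} x≤y y<z
  rewrite G-rotate y z (x + z) (≤⇒≯ (+-monoˡ-≤ z x≤y)) y<z = cong (λ w → just (w , y , z)) (//-rightDividesʳ z x)

lemma33 : (X : Triple) → InP X → (G (mulA1 X) ≡ just X) × (G (mulA0 X) ≡ just X)
lemma33 (x , y , z) (inj₁ (_ , x≤y , y<z)) = G-mulA1 y<z , G-mulA0 x≤y y<z
lemma33 (x , y , z) (inj₂ refl)             = refl , refl
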